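{- For every $P:(E,R)\,\mathsf{itree}$, $P\in\mathsf{divfree}$ if and only if there is no finite list $s$ of events in $E$ such that $P\xrightarrow{s}\mathsf{div}$.
   Context: For a set $E$ of events and a set $R$ of return values, $(E,R)\,\mathsf{itree}$ is the coinductive datatype (possibly infinite trees) with constructors $\mathsf{Ret}\,r$ ($r\in R$), $\mathsf{Sil}\,P$, and $\mathsf{Vis}\,F$ with $F:E\rightharpoonup(E,R)\,\mathsf{itree}$ a partial function ($\mathrm{ran}(F)$ is its range). $\mathsf{div}=\mathsf{Sil}\,\mathsf{div}$ (corecursively). Big-step transitions $P\xrightarrow{tr}P'$: least relation with $P\xrightarrow{[]}P$; $P\xrightarrow{tr}P'$ implies $\mathsf{Sil}\,P\xrightarrow{tr}P'$; $e\in\mathrm{dom}(F)$ and $F(e)\xrightarrow{tr}P'$ imply $\mathsf{Vis}\,F\xrightarrow{e\# tr}P'$ ($e\#tr$ is $tr$ with $e$ prepended). For a set $\mathcal{R}$ of itrees, $P\trianglerighteq\mathcal{R}$ is defined inductively by: $\mathsf{Ret}\,x\trianglerighteq\mathcal{R}$; $P\trianglerighteq\mathcal{R}$ implies $\mathsf{Sil}\,P\trianglerighteq\mathcal{R}$; $\mathrm{ran}(F)\subseteq\mathcal{R}$ implies $\mathsf{Vis}\,F\trianglerighteq\mathcal{R}$. Then $\mathsf{divfree}=\bigcup\{\mathcal{R}\mid\mathcal{R}\subseteq\{P\mid P\trianglerighteq\mathcal{R}\}\}$. -}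

module Defs where

open import Data.List using (List; []; _∷_)
open import Data.Maybe using (Maybe; just; nothing)
import Data.Maybe as M
open import Data.Maybe.Relation.Binary.Pointwise using (Pointwise)
open import Data.Product using (Σ; _×_)
open import Data.Unit using (⊤; tt)
open import Level using (Level)
open import Relation.Binary.PropositionalEquality using (_≡_)

-- Partial functions E ⇀ X are represented as E → Maybe X
-- (dom F = {e | F e = just _}).

data ITreeF (E R : Set) (X : Set₁) : Set₁ where
  Ret : R → ITreeF E R X
  Sil : X → ITreeF E R X
  Vis : (E → Maybe X) → ITreeF E R X

data Shape (E R : Set) (S : Set) : Set where
  Ret : R → Shape E R S
  Sil : S → Shape E R S
  Vis : (E → Maybe S) → Shape E R S

record ITree (E R : Set) : Set₁ where
  constructor itree
  field
    State : Set
    step  : State → Shape E R State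
    start : State

open ITree public

module _ {E R : Set} where

  at : (P : ITree E R) → State P → ITree E R
  at P s = itree (State P) (step P) s

  out : ITree E R → ITreeF E R (ITree E R)
  out P with step P (start P)
  ... | Ret r = Ret r
  ... | Sil s = Sil (at P s)
  ... | Vis F = Vis (λ e → M.map (at P) (F e))

  div : ITree E R
  div = itree ⊤ (λ _ → Sil tt) tt

  data ShapeRel {S T : Set} (B : S → T → Set) : Shape E R S → Shape E R T → Set where
    Ret≅ : ∀ r → ShapeRel B (Ret r) (Ret r)
    Sil≅ : ∀ {s t} → B s t → ShapeRel B (Sil s) (Sil t)
    Vis≅ : ∀ {F G} → (∀ e → Pointwise B (F e) (G e)) → ShapeRel B (Vis F) (Vis G)

  IsBisim : (P Q : ITree E R) → (State P → State Q → Set) → Set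
  IsBisim P Q B = ∀ s t → B s t → ShapeRel B (step P s) (step Q t)

  _≅_ : ITree E R → ITree E R → Set₁
  P ≅ Q = Σ (State P → State Q → Set) λ B → IsBisim P Q B × B (start P) (start Q)

  data _⟶[_]_ : ITree E R → List E → ITree E R → Set₁ where
    stop : ∀ {P} → P ⟶[ [] ] P
    sil  : ∀ {P Q tr P'} → out P ≡ Sil Q → Q ⟶[ tr ] P' → P ⟶[ tr ] P'
    vis  : ∀ {P F e Q tr P'} → out P ≡ Vis F → F e ≡ just Q →
           Q ⟶[ tr ] P' → P ⟶[ e ∷ tr ] P'

  data _⊵_ (P : ITree E R) (𝓡 : ITree E R → Set₁) : Set₁ where
    ret : ∀ {x} → out P ≡ Ret x → P ⊵ 𝓡
    sil : ∀ {Q} → out P ≡ Sil Q → Q ⊵ 𝓡 → P ⊵ 𝓡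
    vis : ∀ {F} → out P ≡ Vis F → (∀ e Q → F e ≡ just Q → 𝓡 Q) → P ⊵ 𝓡

  divfree : ITree E R → Set₂
  divfree P = Σ (ITree E R → Set₁) λ 𝓡 → (∀ Q → 𝓡 Q → Q ⊵ 𝓡) × 𝓡 P

-- A ⊵-derivation is finite while div is an endless chain of silent steps, so
-- no tree with a derivation is bisimilar to div; as a post-fixed point 𝓡 of
-- X ↦ {P | P ⊵ X} is closed under the transitions of its members, none of
-- them reaches div. Conversely, the trees without a divergent trace form such a
-- post-fixed point: classically, a tree of this kind with no derivation must
-- be a silent step to another such tree (Ret and Vis trees have derivations),
-- so these stuck states form a bisimulation with div.
module Submission where

open import Defs
open import Axiom.ExcludedMiddle using (ExcludedMiddle)
open import Data.Empty using (⊥-elim)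
open import Data.List using (List; []; _∷_)
open import Data.Maybe using (just)
import Data.Maybe as Maybe
open import Data.Product using (Σ; _×_; _,_)
open import Data.Unit using (⊤; tt)
open import Function.Bundles using (_⇔_; mk⇔)
open import Level using (0ℓ; suc)
open import Relation.Binary.PropositionalEquality using (_≡_; refl; sym; trans)
open import Relation.Nullary using (¬_; yes; no)
open import Relation.Nullary.Decidable using (True; toWitness; fromWitness)

module _ {E R : Set} where

  Diverges : ITree E R → Set₁
  Diverges P = Σ (List E) λ s → Σ (ITree E R) λ P′ → (P ⟶[ s ] P′) × (P′ ≅ div)

  PostFixed : (ITree E R → Set₁) → Set₁
  PostFixed 𝓡 = ∀ Q → 𝓡 Q → Q ⊵ 𝓡

  out-unique : ∀ {P : ITree E R} {a b} → out P ≡ a → out P ≡ b → a ≡ b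
  out-unique eq eq′ = trans (sym eq) eq′

  out-at-Ret : ∀ (Q : ITree E R) {s r} → step Q s ≡ Ret r → out (at Q s) ≡ Ret r
  out-at-Ret Q eq rewrite eq = refl

  out-at-Sil : ∀ (Q : ITree E R) {s s′} → step Q s ≡ Sil s′ → out (at Q s) ≡ Sil (at Q s′)
  out-at-Sil Q eq rewrite eq = refl

  out-at-Vis : ∀ (Q : ITree E R) {s F} → step Q s ≡ Vis F →
               out (at Q s) ≡ Vis (λ e → Maybe.map (at Q) (F e))
  out-at-Vis Q eq rewrite eq = refl

  ≅div-unfold : ∀ {P : ITree E R} → P ≅ div → Σ (ITree E R) λ Q → (out P ≡ Sil Q) × (Q ≅ div)
  ≅div-unfold {itree S st s₀} (B , isB , b) with st s₀ | isB s₀ tt b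
  ... | Sil s | Sil≅ b′ = itree S st s , refl , (B , isB , b′)

  Diverges-sil : ∀ {P Q : ITree E R} → out P ≡ Sil Q → Diverges Q → Diverges P
  Diverges-sil eq (s , P′ , t , b) = s , P′ , sil eq t , b

  Diverges-vis : ∀ {P Q : ITree E R} {F e} → out P ≡ Vis F → F e ≡ just Q →
                 Diverges Q → Diverges P
  Diverges-vis {e = e} eq Fe (s , P′ , t , b) = e ∷ s , P′ , vis eq Fe t , b

  ⊵⇒≇div : ∀ {P 𝓡} → P ⊵ 𝓡 → ¬ P ≅ div
  ⊵⇒≇div d bis with ≅div-unfold bis
  ⊵⇒≇div (ret eq)   _ | _ , eq′ , _ with out-unique eq eq′
  ... | ()
  ⊵⇒≇div (sil eq d) _ | _ , eq′ , b with out-unique eq eq′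
  ... | refl = ⊵⇒≇div d b
  ⊵⇒≇div (vis eq _) _ | _ , eq′ , _ with out-unique eq eq′
  ... | ()

  ⊵-⟶-≇div : ∀ {𝓡 P s P′} → PostFixed 𝓡 → P ⊵ 𝓡 → P ⟶[ s ] P′ → ¬ P′ ≅ div
  ⊵-⟶-≇div _ d stop = ⊵⇒≇div d
  ⊵-⟶-≇div closed (ret eq) (sil eq′ _) with out-unique eq eq′
  ... | ()
  ⊵-⟶-≇div closed (sil eq d) (sil eq′ t) with out-unique eq eq′
  ... | refl = ⊵-⟶-≇div closed d t
  ⊵-⟶-≇div closed (vis eq _) (sil eq′ _) with out-unique eq eq′
  ... | ()
  ⊵-⟶-≇div closed (ret eq) (vis eq′ _ _) with out-unique eq eq′
  ... | ()
  ⊵-⟶-≇div closed (sil eq _) (vis eq′ _ _) with out-unique eq eq′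
  ... | ()
  ⊵-⟶-≇div closed (vis eq next) (vis {e = e} {Q = Q} eq′ Fe t)
    with out-unique eq eq′
  ... | refl = ⊵-⟶-≇div closed (closed Q (next e Q Fe)) t

  PostFixed⇒¬Diverges : ∀ {𝓡 P} → PostFixed 𝓡 → 𝓡 P → ¬ Diverges P
  PostFixed⇒¬Diverges closed rP (_ , _ , t , b) = ⊵-⟶-≇div closed (closed _ rP) t b

  module Classical (lem : ExcludedMiddle (suc 0ℓ)) where

    NonDivergent : ITree E R → Set₁
    NonDivergent P = ¬ Diverges P

    Stuck : ITree E R → Set₁
    Stuck P = NonDivergent P × ¬ (P ⊵ NonDivergent)

    stuck-step : ∀ (Q : ITree E R) s → Stuck (at Q s) →
                 Σ (State Q) λ s′ → (step Q s ≡ Sil s′) × Stuck (at Q s′)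
    stuck-step Q s (nd , nv) with step Q s in eq
    ... | Ret r = ⊥-elim (nv (ret (out-at-Ret Q eq)))
    ... | Sil s′ = s′ , refl , (λ dv → nd (Diverges-sil (out-at-Sil Q eq) dv))
                             , (λ d → nv (sil (out-at-Sil Q eq) d))
    ... | Vis F = ⊥-elim (nv (vis (out-at-Vis Q eq)
                    λ e Q′ Fe dv → nd (Diverges-vis (out-at-Vis Q eq) Fe dv)))

    -- Stuck is a proposition in Set₁; excluded middle turns it into the
    -- Set-valued relation that a bisimulation requires.
    stuck⇒≅div : ∀ {P : ITree E R} → Stuck P → P ≅ div
    stuck⇒≅div {P} stuck = B , isBisim , fromWitness stuck
      where
        B : State P → ⊤ → Set
        B s _ = True (lem {Stuck (at P s)})

        isBisim : IsBisim P div B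
        isBisim s tt b with stuck-step P s (toWitness b)
        ... | s′ , eq , stuck′ rewrite eq = Sil≅ (fromWitness stuck′)

    nonDivergent-postFixed : PostFixed NonDivergent
    nonDivergent-postFixed Q nd with lem {Q ⊵ NonDivergent}
    ... | yes d = d
    ... | no nv = ⊥-elim (nd ([] , Q , stop , stuck⇒≅div (nd , nv)))

mainTheorem11 : ExcludedMiddle (suc 0ℓ) → {E R : Set} (P : ITree E R) →
    divfree P ⇔ (¬ Σ (List E) λ s → Σ (ITree E R) λ P' → (P ⟶[ s ] P') × (P' ≅ div))
mainTheorem11 lem P = mk⇔
  (λ { (𝓡 , closed , rP) → PostFixed⇒¬Diverges closed rP })
  (λ nd → NonDivergent , nonDivergent-postFixed , nd)
  where open Classical lem
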